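{- For every integer $n \geq 1$, $$j(n) = 2\sum_{m \geq 1} (-1)^{m+1}\, j(n-m^2),$$ where $j(k)=0$ for $k<0$.
   Context: A 01-partition (jagged partition) of a non-negative integer $n$ is a finite sequence $(n_1,\dots,n_m)$ of non-negative integers with $\sum_i n_i = n$, whose last entry satisfies $n_m \geq 1$, and such that $n_j \geq n_{j+1}-1$ and $n_j \geq n_{j+2}$ whenever the indices are in range. The empty sequence is the unique 01-partition of $0$. $j(n)$ denotes the number of 01-partitions of $n$. -}

module Defs where

open import Data.Nat using (ℕ; zero; suc; _+_; _*_; _≤_; _≥_; _∸_; _≤?_)
open import Data.Nat.Properties using (_≟_)
open import Data.Nat.ListAction using (sum)
open import Data.List using (List; []; _∷_; length; filter; map; concatMap; upTo)
open import Data.Integer as ℤ using (ℤ; +_; -_)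
open import Data.Product using (_×_)
open import Data.Unit using (⊤)
open import Relation.Nullary using (Dec; yes; no)
open import Relation.Nullary.Decidable using (_×-dec_)
open import Relation.Binary.PropositionalEquality using (_≡_)

-- Local jaggedness conditions: for consecutive entries a, b, c, ...
--   n_j ≥ n_{j+1} - 1  (written  n_{j+1} ≤ n_j + 1)  and  n_j ≥ n_{j+2}.
-- Last entry ≥ 1.
Jagged : List ℕ → Set
Jagged [] = ⊤
Jagged (a ∷ []) = 1 ≤ a
Jagged (a ∷ b ∷ []) = (b ≤ a + 1) × Jagged (b ∷ [])
Jagged (a ∷ b ∷ c ∷ rest) = (b ≤ a + 1) × (c ≤ a) × Jagged (b ∷ c ∷ rest)

jagged? : (l : List ℕ) → Dec (Jagged l)
jagged? [] = yes _
jagged? (a ∷ []) = 1 ≤? a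
jagged? (a ∷ b ∷ []) = (b ≤? a + 1) ×-dec jagged? (b ∷ [])
jagged? (a ∷ b ∷ c ∷ rest) = (b ≤? a + 1) ×-dec ((c ≤? a) ×-dec jagged? (b ∷ c ∷ rest))

Is01Partition : ℕ → List ℕ → Set
Is01Partition n l = (sum l ≡ n) × Jagged l

is01Partition? : (n : ℕ) → (l : List ℕ) → Dec (Is01Partition n l)
is01Partition? n l = (sum l ≟ n) ×-dec jagged? l

listsOfLength : ℕ → ℕ → List (List ℕ)
listsOfLength b zero = [] ∷ []
listsOfLength b (suc k) = concatMap (λ x → map (x ∷_) (listsOfLength b k)) (upTo (suc b))

listsUpTo : ℕ → ℕ → List (List ℕ)
listsUpTo b zero = listsOfLength b zero
listsUpTo b (suc L) = listsUpTo b L Data.List.++ listsOfLength b (suc L)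

-- Every 01-partition of n has entries ≤ n and length ≤ 2n (every second
-- entry counted from the end is ≥ 1, since n_j ≥ n_{j+2} and n_m ≥ 1),
-- so the following search space contains all of them, each exactly once.
-- j n = number of 01-partitions of n.
j : ℕ → ℕ
j n = length (filter (is01Partition? n) (listsUpTo n (2 * n)))

jShift : ℕ → ℕ → ℕ
jShift n m with m * m ≤? n
... | yes _ = j (n ∸ m * m)
... | no _ = 0

sgn : ℕ → ℤ
sgn zero = ℤ.-[1+ 0 ]
sgn (suc zero) = + 1
sgn (suc (suc m)) = sgn m

altSum : ℕ → ℕ → ℤ
altSum n zero = + 0
altSum n (suc N) = altSum n N ℤ.+ sgn (suc N) ℤ.* (+ jShift n (suc N))

{-# OPTIONS --safe #-}
module Submission where

open import Defs
open import Data.Nat using (ℕ; _≥_)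
open import Data.Integer using (+_; _*_)
open import Relation.Binary.PropositionalEquality using (_≡_)

-- Read from the front, a 01-partition factors uniquely into blocks [u] (u ≥ 1) and [a, a+1]
-- (a ≥ 0) whose indices 2u resp. 2a+1 weakly decrease, so Σ j(n) qⁿ = J = P · O with
-- P = ∏_{k ≥ 1} 1/(1 - qᵏ) and O = ∏_{a ≥ 0} 1/(1 - q^(2a+1)).  Gauss's identity
-- Θ = Σ_{k ∈ ℤ} (-1)ᵏ q^(k²) = ∏_{k ≥ 1} (1 - qᵏ)/(1 + qᵏ) = 1/(P · O) gives Θ · J = 1, and the
-- coefficient of qⁿ in Θ · J is j(n) - 2 Σ_{m ≥ 1} (-1)^(m+1) j(n - m²).
-- Working modulo q^(N+1) with finite products, Gauss's identity in the form Θ · P² = 1/(q²;q²)_∞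
-- follows from the finite identity Σ_k (-1)ᵏ q^(k²) / ((q;q)_(N+k) (q;q)_(N-k)) = 1/(q²;q²)_N,
-- which is proved by induction on N.

module PowerSeries where

  open import Data.Nat as ℕ using (zero; suc; _≤_; _<_; z≤n; s≤s; _∸_)
  import Data.Nat.Properties as ℕₚ
  open import Data.Integer using (ℤ; 0ℤ; 1ℤ; _+_)
  import Data.Integer.Properties as ℤₚ
  open import Data.Integer.Tactic.RingSolver using (solve-∀)
  open import Algebra.Bundles using (CommutativeMonoid)
  import Algebra.Properties.CommutativeSemigroup
  import Algebra.Properties.CommutativeSemigroup ℤₚ.+-commutativeSemigroup as ℤ+
  open import Algebra.Properties.AbelianGroup ℤₚ.+-0-abelianGroup using (∙-cancelʳ)
  open import Data.Product using (_,_)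
  open import Data.Sum using (_⊎_; inj₁; inj₂)
  open import Function using (_∘_)
  open import Relation.Binary.Bundles using (Setoid)
  import Relation.Binary.Reasoning.Setoid
  open import Relation.Binary.Structures using (IsEquivalence)
  open import Relation.Binary.PropositionalEquality

  Series : Set
  Series = ℕ → ℤ

  infix  4 _≈[_]_
  infixl 6 _⊕_
  infixl 7 _⊛_
  infixr 8 _·_

  𝟘 𝟙 : Series
  𝟘 _ = 0ℤ
  𝟙 zero    = 1ℤ
  𝟙 (suc _) = 0ℤ

  _⊕_ : Series → Series → Series
  (f ⊕ g) n = f n + g n

  _·_ : ℤ → Series → Series
  (a · f) n = a * f n

  shift : ℕ → Series → Series
  shift zero    f n       = f n
  shift (suc e) f zero    = 0ℤ
  shift (suc e) f (suc n) = shift e f n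

  _⊛_ : Series → Series → Series
  (f ⊛ g) zero    = f 0 * g 0
  (f ⊛ g) (suc n) = f 0 * g (suc n) + (f ∘ suc ⊛ g) n

  _≈[_]_ : Series → ℕ → Series → Set
  f ≈[ N ] g = ∀ n → n ≤ N → f n ≡ g n

  ≈[]-isEquivalence : ∀ N → IsEquivalence _≈[ N ]_
  ≈[]-isEquivalence N = record
    { refl  = λ _ _ → refl
    ; sym   = λ p n n≤N → sym (p n n≤N)
    ; trans = λ p q n n≤N → trans (p n n≤N) (q n n≤N)
    }

  ≈[]-setoid : ℕ → Setoid _ _
  ≈[]-setoid N = record { isEquivalence = ≈[]-isEquivalence N }

  open Setoid (ℕ →-setoid ℤ) public using ()
    renaming (refl to ≗-refl; sym to ≗-sym; trans to ≗-trans)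

  module ≗-Reasoning = Relation.Binary.Reasoning.Setoid (ℕ →-setoid ℤ)
  module ≈[]-Reasoning (N : ℕ) = Relation.Binary.Reasoning.Setoid (≈[]-setoid N)

  module _ {N : ℕ} where
    open IsEquivalence (≈[]-isEquivalence N) public using ()
      renaming (refl to ≈[]-refl; sym to ≈[]-sym; trans to ≈[]-trans)

  ≗⇒≈[] : ∀ {f g} N → f ≗ g → f ≈[ N ] g
  ≗⇒≈[] N p n _ = p n

  ≈[]-weaken : ∀ {f g M N} → M ≤ N → f ≈[ N ] g → f ≈[ M ] g
  ≈[]-weaken M≤N p n n≤M = p n (ℕₚ.≤-trans n≤M M≤N)

  ⊕-cong : ∀ {f f′ g g′} → f ≗ f′ → g ≗ g′ → f ⊕ g ≗ f′ ⊕ g′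
  ⊕-cong p q n = cong₂ _+_ (p n) (q n)

  ·-cong : ∀ a {f g} → f ≗ g → a · f ≗ a · g
  ·-cong a p n = cong (a *_) (p n)

  ·-cong[] : ∀ a {f g N} → f ≈[ N ] g → a · f ≈[ N ] a · g
  ·-cong[] a p n n≤N = cong (a *_) (p n n≤N)

  ·-distrib-⊕ : ∀ a f g → a · (f ⊕ g) ≗ a · f ⊕ a · g
  ·-distrib-⊕ a f g n = ℤₚ.*-distribˡ-+ a (f n) (g n)

  ·-zero : ∀ a → a · 𝟘 ≗ 𝟘
  ·-zero a n = ℤₚ.*-zeroʳ a

  shift-cong : ∀ e {f g} → f ≗ g → shift e f ≗ shift e g
  shift-cong zero    p n       = p n
  shift-cong (suc e) p zero    = refl
  shift-cong (suc e) p (suc n) = shift-cong e p n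

  shift-cong[] : ∀ e {f g N} → f ≈[ N ] g → shift e f ≈[ e ℕ.+ N ] shift e g
  shift-cong[] zero    p n       n≤N       = p n n≤N
  shift-cong[] (suc e) p zero    _         = refl
  shift-cong[] (suc e) p (suc n) (s≤s n≤N) = shift-cong[] e p n n≤N

  shift-below : ∀ e f {n} → n < e → shift e f n ≡ 0ℤ
  shift-below (suc e) f {zero}  _         = refl
  shift-below (suc e) f {suc n} (s≤s n<e) = shift-below e f n<e

  shift-at : ∀ e f {n} → e ≤ n → shift e f n ≡ f (n ∸ e)
  shift-at zero    f         _         = refl
  shift-at (suc e) f {suc n} (s≤s e≤n) = shift-at e f e≤n

  shift-small : ∀ e f {N} → N < e → shift e f ≈[ N ] 𝟘
  shift-small e f N<e n n≤N = shift-below e f (ℕₚ.≤-<-trans n≤N N<e)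

  shift-𝟘 : ∀ e → shift e 𝟘 ≗ 𝟘
  shift-𝟘 zero    n       = refl
  shift-𝟘 (suc e) zero    = refl
  shift-𝟘 (suc e) (suc n) = shift-𝟘 e n

  shift-+ : ∀ a b f → shift (a ℕ.+ b) f ≗ shift a (shift b f)
  shift-+ zero    b f n       = refl
  shift-+ (suc a) b f zero    = refl
  shift-+ (suc a) b f (suc n) = shift-+ a b f n

  shift-exponent : ∀ {e e′} X → e ≡ e′ ⊎ X ≗ 𝟘 → shift e X ≗ shift e′ X
  shift-exponent X (inj₁ refl) = ≗-refl
  shift-exponent {e} {e′} X (inj₂ X≗𝟘) =
    ≗-trans (shift-cong e X≗𝟘)
            (≗-trans (shift-𝟘 e) (≗-sym (≗-trans (shift-cong e′ X≗𝟘) (shift-𝟘 e′))))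

  shift-⊕ : ∀ e f g → shift e (f ⊕ g) ≗ shift e f ⊕ shift e g
  shift-⊕ zero    f g n       = refl
  shift-⊕ (suc e) f g zero    = refl
  shift-⊕ (suc e) f g (suc n) = shift-⊕ e f g n

  shift-· : ∀ e a f → shift e (a · f) ≗ a · shift e f
  shift-· zero    a f n       = refl
  shift-· (suc e) a f zero    = sym (ℤₚ.*-zeroʳ a)
  shift-· (suc e) a f (suc n) = shift-· e a f n

  ⊕-interchange : ∀ f g h k → (f ⊕ g) ⊕ (h ⊕ k) ≗ (f ⊕ h) ⊕ (g ⊕ k)
  ⊕-interchange f g h k n = ℤ+.interchange (f n) (g n) (h n) (k n)

  ⊕-identityʳ : ∀ f → f ⊕ 𝟘 ≗ f
  ⊕-identityʳ f n = ℤₚ.+-identityʳ (f n)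

  ⊕-identityˡ : ∀ f → 𝟘 ⊕ f ≗ f
  ⊕-identityˡ f n = ℤₚ.+-identityˡ (f n)

  ⊛-cong : ∀ {f f′ g g′} → f ≗ f′ → g ≗ g′ → f ⊛ g ≗ f′ ⊛ g′
  ⊛-cong p q zero    = cong₂ _*_ (p 0) (q 0)
  ⊛-cong p q (suc n) = cong₂ _+_ (cong₂ _*_ (p 0) (q (suc n))) (⊛-cong (p ∘ suc) q n)

  ⊛-cong[] : ∀ {f f′ g g′ N} → f ≈[ N ] f′ → g ≈[ N ] g′ → f ⊛ g ≈[ N ] f′ ⊛ g′
  ⊛-cong[] p q zero _ = cong₂ _*_ (p 0 z≤n) (q 0 z≤n)
  ⊛-cong[] {N = suc N} p q (suc n) (s≤s n≤N) =
    cong₂ _+_ (cong₂ _*_ (p 0 z≤n) (q (suc n) (s≤s n≤N)))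
              (⊛-cong[] (λ m m≤N → p (suc m) (s≤s m≤N)) (≈[]-weaken (ℕₚ.n≤1+n N) q) n n≤N)

  ⊛-zeroˡ : ∀ g → 𝟘 ⊛ g ≗ 𝟘
  ⊛-zeroˡ g zero    = ℤₚ.*-zeroˡ (g 0)
  ⊛-zeroˡ g (suc n) = cong₂ _+_ (ℤₚ.*-zeroˡ (g (suc n))) (⊛-zeroˡ g n)

  ⊛-identityˡ : ∀ g → 𝟙 ⊛ g ≗ g
  ⊛-identityˡ g zero    = ℤₚ.*-identityˡ (g 0)
  ⊛-identityˡ g (suc n) = trans (cong₂ _+_ (ℤₚ.*-identityˡ (g (suc n))) (⊛-zeroˡ g n)) (ℤₚ.+-identityʳ _)

  ⊛-comm : ∀ f g → f ⊛ g ≗ g ⊛ f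
  ⊛-comm f g zero          = ℤₚ.*-comm (f 0) (g 0)
  ⊛-comm f g (suc zero)    = swap (f 0) (g 1) (f 1) (g 0)
    where
    swap : ∀ a b c d → a * b + c * d ≡ d * c + b * a
    swap = solve-∀
  ⊛-comm f g (suc (suc n)) = begin
    f 0 * g (2 ℕ.+ n) + (f ∘ suc ⊛ g) (suc n)
      ≡⟨ cong (_+_ (f 0 * g (2 ℕ.+ n))) (⊛-comm (f ∘ suc) g (suc n)) ⟩
    f 0 * g (2 ℕ.+ n) + (g 0 * f (2 ℕ.+ n) + (g ∘ suc ⊛ f ∘ suc) n)
      ≡⟨ ℤ+.x∙yz≈y∙xz (f 0 * g (2 ℕ.+ n)) (g 0 * f (2 ℕ.+ n)) _ ⟩
    g 0 * f (2 ℕ.+ n) + (f 0 * g (2 ℕ.+ n) + (g ∘ suc ⊛ f ∘ suc) n)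
      ≡⟨ cong (λ x → g 0 * f (2 ℕ.+ n) + (f 0 * g (2 ℕ.+ n) + x)) (⊛-comm (g ∘ suc) (f ∘ suc) n) ⟩
    g 0 * f (2 ℕ.+ n) + (f 0 * g (2 ℕ.+ n) + (f ∘ suc ⊛ g ∘ suc) n)
      ≡⟨ cong (_+_ (g 0 * f (2 ℕ.+ n))) (⊛-comm f (g ∘ suc) (suc n)) ⟩
    g 0 * f (2 ℕ.+ n) + (g ∘ suc ⊛ f) (suc n) ∎
    where open ≡-Reasoning

  ⊛-distribʳ-⊕ : ∀ f g h → (f ⊕ g) ⊛ h ≗ f ⊛ h ⊕ g ⊛ h
  ⊛-distribʳ-⊕ f g h zero    = ℤₚ.*-distribʳ-+ (h 0) (f 0) (g 0)
  ⊛-distribʳ-⊕ f g h (suc n) =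
    trans (cong₂ _+_ (ℤₚ.*-distribʳ-+ (h (suc n)) (f 0) (g 0)) (⊛-distribʳ-⊕ (f ∘ suc) (g ∘ suc) h n))
          (ℤ+.interchange (f 0 * h (suc n)) (g 0 * h (suc n)) ((f ∘ suc ⊛ h) n) ((g ∘ suc ⊛ h) n))

  ⊛-·ˡ : ∀ a f g → (a · f) ⊛ g ≗ a · (f ⊛ g)
  ⊛-·ˡ a f g zero    = ℤₚ.*-assoc a (f 0) (g 0)
  ⊛-·ˡ a f g (suc n) =
    trans (cong₂ _+_ (ℤₚ.*-assoc a (f 0) (g (suc n))) (⊛-·ˡ a (f ∘ suc) g n))
          (sym (ℤₚ.*-distribˡ-+ a _ _))

  ⊛-shiftˡ : ∀ e f g → shift e f ⊛ g ≗ shift e (f ⊛ g)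
  ⊛-shiftˡ zero    f g n       = refl
  ⊛-shiftˡ (suc e) f g zero    = ℤₚ.*-zeroˡ (g 0)
  ⊛-shiftˡ (suc e) f g (suc n) =
    trans (cong₂ _+_ (ℤₚ.*-zeroˡ (g (suc n))) (⊛-shiftˡ e f g n)) (ℤₚ.+-identityˡ _)

  ⊛-assoc : ∀ f g h → (f ⊛ g) ⊛ h ≗ f ⊛ (g ⊛ h)
  ⊛-assoc f g h zero    = ℤₚ.*-assoc (f 0) (g 0) (h 0)
  ⊛-assoc f g h (suc n) = begin
    (f 0 * g 0) * h (suc n) + ((f 0 · (g ∘ suc) ⊕ (f ∘ suc ⊛ g)) ⊛ h) n
      ≡⟨ cong (_+_ ((f 0 * g 0) * h (suc n))) (⊛-distribʳ-⊕ (f 0 · (g ∘ suc)) (f ∘ suc ⊛ g) h n) ⟩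
    (f 0 * g 0) * h (suc n) + (((f 0 · (g ∘ suc)) ⊛ h) n + ((f ∘ suc ⊛ g) ⊛ h) n)
      ≡⟨ cong₂ (λ x y → (f 0 * g 0) * h (suc n) + (x + y))
               (⊛-·ˡ (f 0) (g ∘ suc) h n) (⊛-assoc (f ∘ suc) g h n) ⟩
    (f 0 * g 0) * h (suc n) + (f 0 * (g ∘ suc ⊛ h) n + (f ∘ suc ⊛ (g ⊛ h)) n)
      ≡⟨ sym (ℤₚ.+-assoc ((f 0 * g 0) * h (suc n)) (f 0 * (g ∘ suc ⊛ h) n) _) ⟩
    (f 0 * g 0) * h (suc n) + f 0 * (g ∘ suc ⊛ h) n + (f ∘ suc ⊛ (g ⊛ h)) n
      ≡⟨ cong (_+ (f ∘ suc ⊛ (g ⊛ h)) n)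
              (trans (cong (_+ f 0 * (g ∘ suc ⊛ h) n) (ℤₚ.*-assoc (f 0) (g 0) (h (suc n))))
                     (sym (ℤₚ.*-distribˡ-+ (f 0) _ _))) ⟩
    f 0 * (g ⊛ h) (suc n) + (f ∘ suc ⊛ (g ⊛ h)) n ∎
    where open ≡-Reasoning

  ⊛-commutativeMonoid : CommutativeMonoid _ _
  ⊛-commutativeMonoid = record
    { Carrier             = Series
    ; _≈_                 = _≗_
    ; _∙_                 = _⊛_
    ; ε                   = 𝟙
    ; isCommutativeMonoid = record
      { isMonoid = record
        { isSemigroup = record
          { isMagma = record { isEquivalence = Setoid.isEquivalence (ℕ →-setoid ℤ) ; ∙-cong = ⊛-cong }
          ; assoc   = ⊛-assoc
          }
        ; identity = ⊛-identityˡ , λ f n → trans (⊛-comm f 𝟙 n) (⊛-identityˡ f n)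
        }
      ; comm = ⊛-comm
      }
    }

  open CommutativeMonoid ⊛-commutativeMonoid public using () renaming (identityʳ to ⊛-identityʳ)
  module ⊛ = Algebra.Properties.CommutativeSemigroup (CommutativeMonoid.commutativeSemigroup ⊛-commutativeMonoid)

  ⊛-zeroʳ : ∀ f → f ⊛ 𝟘 ≗ 𝟘
  ⊛-zeroʳ f n = trans (⊛-comm f 𝟘 n) (⊛-zeroˡ f n)

  ⊛-vanishesˡ : ∀ {f} g → f ≗ 𝟘 → f ⊛ g ≗ 𝟘
  ⊛-vanishesˡ g f≗𝟘 = ≗-trans (⊛-cong f≗𝟘 (≗-refl {g})) (⊛-zeroˡ g)

  ⊛-vanishesʳ : ∀ f {g} → g ≗ 𝟘 → f ⊛ g ≗ 𝟘
  ⊛-vanishesʳ f g≗𝟘 = ≗-trans (⊛-cong (≗-refl {f}) g≗𝟘) (⊛-zeroʳ f)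

  ⊛-distribˡ-⊕ : ∀ f g h → f ⊛ (g ⊕ h) ≗ f ⊛ g ⊕ f ⊛ h
  ⊛-distribˡ-⊕ f g h n = trans (⊛-comm f (g ⊕ h) n)
    (trans (⊛-distribʳ-⊕ g h f n) (cong₂ _+_ (⊛-comm g f n) (⊛-comm h f n)))

  ⊛-shiftʳ : ∀ e f g → f ⊛ shift e g ≗ shift e (f ⊛ g)
  ⊛-shiftʳ e f g n = trans (⊛-comm f (shift e g) n)
    (trans (⊛-shiftˡ e g f n) (shift-cong e (⊛-comm g f) n))

  shift-⊛-shift : ∀ a b f g → shift a f ⊛ shift b g ≗ shift (a ℕ.+ b) (f ⊛ g)
  shift-⊛-shift a b f g =
    ≗-trans (⊛-shiftˡ a f (shift b g)) (≗-trans (shift-cong a (⊛-shiftʳ b f g)) (≗-sym (shift-+ a b (f ⊛ g))))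

  ≈[]-base : ∀ {f g} → f 0 ≡ g 0 → f ≈[ 0 ] g
  ≈[]-base p zero z≤n = p

  ≈[]-extend : ∀ {f g N} → f ≈[ N ] g → f (suc N) ≡ g (suc N) → f ≈[ suc N ] g
  ≈[]-extend {N = N} p q n n≤1+N with ℕₚ.m≤n⇒m<n∨m≡n n≤1+N
  ... | inj₁ (s≤s n≤N) = p n n≤N
  ... | inj₂ refl      = q

  private
    unit-cancel : ∀ {u x y} → u ≡ 1ℤ → u * x ≡ u * y → x ≡ y
    unit-cancel refl eq = trans (sym (ℤₚ.*-identityˡ _)) (trans eq (ℤₚ.*-identityˡ _))

  ⊛-cancelˡ[] : ∀ {g f f′} N → g 0 ≡ 1ℤ → g ⊛ f ≈[ N ] g ⊛ f′ → f ≈[ N ] f′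
  ⊛-cancelˡ[] zero g₀≡1 p = ≈[]-base (unit-cancel g₀≡1 (p 0 z≤n))
  ⊛-cancelˡ[] {g} {f} {f′} (suc N) g₀≡1 p =
    ≈[]-extend IH (unit-cancel g₀≡1 (∙-cancelʳ ((g ∘ suc ⊛ f) N) _ _ top))
    where
    IH : f ≈[ N ] f′
    IH = ⊛-cancelˡ[] N g₀≡1 (≈[]-weaken (ℕₚ.n≤1+n N) p)
    top : g 0 * f (suc N) + (g ∘ suc ⊛ f) N ≡ g 0 * f′ (suc N) + (g ∘ suc ⊛ f) N
    top = trans (p (suc N) ℕₚ.≤-refl)
                (cong (_+_ (g 0 * f′ (suc N))) (sym (⊛-cong[] (λ _ _ → refl) IH N ℕₚ.≤-refl)))

  -- geom k = 1/(1 - q^(1+k)), and geomFrom k c = shift c (geom k) for c ≤ k.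
  private
    geomFrom : ℕ → ℕ → Series
    geomFrom k zero    zero    = 1ℤ
    geomFrom k (suc c) zero    = 0ℤ
    geomFrom k zero    (suc n) = geomFrom k k n
    geomFrom k (suc c) (suc n) = geomFrom k c n

  geom : ℕ → Series
  geom k = geomFrom k 0

  private
    geomFrom-shift : ∀ k c → geomFrom k c ≗ shift c (geom k)
    geomFrom-shift k zero    n       = refl
    geomFrom-shift k (suc c) zero    = refl
    geomFrom-shift k (suc c) (suc n) = geomFrom-shift k c n

  geom-unfold : ∀ k → geom k ≗ 𝟙 ⊕ shift (suc k) (geom k)
  geom-unfold k zero    = refl
  geom-unfold k (suc n) = trans (geomFrom-shift k k n) (sym (ℤₚ.+-identityˡ _))

  geom≈[]𝟙 : ∀ k → geom k ≈[ k ] 𝟙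
  geom≈[]𝟙 k zero    _   = refl
  geom≈[]𝟙 k (suc n) n<k = trans (geomFrom-shift k k n) (shift-below k (geom k) n<k)

  ⊛-geom-unfold : ∀ k g → g ⊛ geom k ≗ g ⊕ shift (suc k) (g ⊛ geom k)
  ⊛-geom-unfold k g = begin
    g ⊛ geom k                                ≈⟨ ⊛-cong (≗-refl {g}) (geom-unfold k) ⟩
    g ⊛ (𝟙 ⊕ shift (suc k) (geom k))          ≈⟨ ⊛-distribˡ-⊕ g 𝟙 _ ⟩
    g ⊛ 𝟙 ⊕ g ⊛ shift (suc k) (geom k)        ≈⟨ ⊕-cong (⊛-identityʳ g) (⊛-shiftʳ (suc k) g (geom k)) ⟩
    g ⊕ shift (suc k) (g ⊛ geom k)            ∎
    where open ≗-Reasoning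

  ⊛-geom-unique : ∀ k {F g} → F ≗ g ⊕ shift (suc k) F → F ≗ g ⊛ geom k
  ⊛-geom-unique k {F} {g} F-eq n = agree n n ℕₚ.≤-refl
    where
    H : Series
    H = g ⊛ geom k
    agree : ∀ N → F ≈[ N ] H
    agree zero    = ≈[]-base (trans (F-eq 0) (sym (⊛-geom-unfold k g 0)))
    agree (suc N) m m≤1+N = begin
      F m                          ≡⟨ F-eq m ⟩
      g m + shift (suc k) F m      ≡⟨ cong (_+_ (g m)) (shift-cong[] (suc k) (agree N) m m≤1+k+N) ⟩
      g m + shift (suc k) H m      ≡⟨ sym (⊛-geom-unfold k g m) ⟩
      H m                          ∎
      where
      open ≡-Reasoning
      m≤1+k+N : m ≤ suc (k ℕ.+ N)
      m≤1+k+N = ℕₚ.≤-trans m≤1+N (s≤s (ℕₚ.m≤n+m N k))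

  ∏geom : (ℕ → ℕ) → ℕ → Series
  ∏geom e zero    = 𝟙
  ∏geom e (suc n) = ∏geom e n ⊛ geom (e n)

  ∏geom-cong : ∀ {e e′} → (∀ k → e k ≡ e′ k) → ∀ n → ∏geom e n ≗ ∏geom e′ n
  ∏geom-cong eq zero    = λ _ → refl
  ∏geom-cong eq (suc n) = ⊛-cong (∏geom-cong eq n) (λ m → cong (λ k → geom k m) (eq n))

  ∏geom-constant : ∀ e n → ∏geom e n 0 ≡ 1ℤ
  ∏geom-constant e zero    = refl
  ∏geom-constant e (suc n) = cong (_* 1ℤ) (∏geom-constant e n)

  ∏geom-split : ∀ e N →
                ∏geom e (N ℕ.+ N) ≗ ∏geom (λ k → e (k ℕ.+ k)) N ⊛ ∏geom (λ k → e (suc (k ℕ.+ k))) N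
  ∏geom-split e zero    n = sym (⊛-identityˡ 𝟙 n)
  ∏geom-split e (suc N) rewrite ℕₚ.+-suc N N = begin
    ∏geom e (N ℕ.+ N) ⊛ x ⊛ y  ≈⟨ ⊛-cong (⊛-cong (∏geom-split e N) ≗-refl) ≗-refl ⟩
    (A ⊛ B) ⊛ x ⊛ y            ≈⟨ ⊛-assoc (A ⊛ B) x y ⟩
    (A ⊛ B) ⊛ (x ⊛ y)          ≈⟨ ⊛.interchange A B x y ⟩
    (A ⊛ x) ⊛ (B ⊛ y)          ∎
    where
    open ≗-Reasoning
    A B x y : Series
    A = ∏geom (λ k → e (k ℕ.+ k)) N
    B = ∏geom (λ k → e (suc (k ℕ.+ k))) N
    x = geom (e (N ℕ.+ N))
    y = geom (e (suc (N ℕ.+ N)))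


module SymmetricSums where

  open PowerSeries
  open import Data.Nat using (zero; suc; _<_; z≤n; s≤s)
  open import Data.Integer using (ℤ; +_; -[1+_]; 0ℤ; _+_; -_; ∣_∣)
  import Data.Integer.Properties as ℤₚ
  import Data.Integer.Tactic.RingSolver as ℤ-Solver
  open import Function using (_∘_)
  open import Relation.Binary.PropositionalEquality

  symSum : ℕ → (ℤ → Series) → Series
  symSum zero    H = H (+ 0)
  symSum (suc R) H = symSum R H ⊕ (H (+ suc R) ⊕ H -[1+ R ])

  symSum-cong : ∀ R {H H′} → (∀ j → H j ≗ H′ j) → symSum R H ≗ symSum R H′
  symSum-cong zero    p = p (+ 0)
  symSum-cong (suc R) p = ⊕-cong (symSum-cong R p) (⊕-cong (p _) (p _))

  symSum-cong[] : ∀ R {H H′ N} → (∀ j → H j ≈[ N ] H′ j) → symSum R H ≈[ N ] symSum R H′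
  symSum-cong[] zero    p         = p (+ 0)
  symSum-cong[] (suc R) p n n≤N =
    cong₂ _+_ (symSum-cong[] R p n n≤N) (cong₂ _+_ (p _ n n≤N) (p _ n n≤N))

  symSum-⊕ : ∀ R H H′ → symSum R (λ j → H j ⊕ H′ j) ≗ symSum R H ⊕ symSum R H′
  symSum-⊕ zero    H H′ = ≗-refl
  symSum-⊕ (suc R) H H′ =
    ≗-trans (⊕-cong (symSum-⊕ R H H′) (⊕-interchange (H (+ suc R)) (H′ (+ suc R)) (H -[1+ R ]) (H′ -[1+ R ])))
            (⊕-interchange (symSum R H) (symSum R H′) _ _)

  symSum-reflect : ∀ R H → symSum R (H ∘ -_) ≗ symSum R H
  symSum-reflect zero    H = ≗-refl
  symSum-reflect (suc R) H = ⊕-cong (symSum-reflect R H) (λ n → ℤₚ.+-comm (H -[1+ R ] n) (H (+ suc R) n))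

  symSum-shift : ∀ R e H → symSum R (shift e ∘ H) ≗ shift e (symSum R H)
  symSum-shift zero    e H = ≗-refl
  symSum-shift (suc R) e H =
    ≗-trans (⊕-cong (symSum-shift R e H) (≗-sym (shift-⊕ e _ _))) (≗-sym (shift-⊕ e _ _))

  ⊛-symSumˡ : ∀ R H g → symSum R H ⊛ g ≗ symSum R (λ j → H j ⊛ g)
  ⊛-symSumˡ zero    H g = ≗-refl
  ⊛-symSumˡ (suc R) H g =
    ≗-trans (⊛-distribʳ-⊕ _ _ g) (⊕-cong (⊛-symSumˡ R H g) (⊛-distribʳ-⊕ _ _ g))

  symSum-central : ∀ R H → (∀ j → 0 < ∣ j ∣ → H j ≗ 𝟘) → symSum R H ≗ H (+ 0)
  symSum-central zero    H _ = ≗-refl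
  symSum-central (suc R) H H≗𝟘 =
    ≗-trans (⊕-cong (symSum-central R H H≗𝟘) (⊕-cong (H≗𝟘 _ (s≤s z≤n)) (H≗𝟘 _ (s≤s z≤n))))
            (≗-trans (⊕-cong (≗-refl {H (+ 0)}) (⊕-identityʳ 𝟘)) (⊕-identityʳ (H (+ 0))))

  -- The terms j and -1-j cancel in pairs, leaving only H (-1-R) unpaired.
  symSum-antisym : ∀ R H → (∀ i n → H -[1+ i ] n ≡ - H (+ i) n) → H -[1+ R ] ≗ 𝟘 → symSum R H ≗ 𝟘
  symSum-antisym R H anti H[-1-R]≗𝟘 = begin
    symSum R H                 ≈⟨ ⊕-identityʳ (symSum R H) ⟨
    symSum R H ⊕ 𝟘             ≈⟨ ⊕-cong (≗-refl {symSum R H}) H[-1-R]≗𝟘 ⟨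
    symSum R H ⊕ H -[1+ R ]    ≈⟨ paired R ⟩
    𝟘                          ∎
    where
    open ≗-Reasoning
    regroup : ∀ a b c d → (a + (b + c)) + d ≡ (a + c) + (b + d)
    regroup = ℤ-Solver.solve-∀
    cancels : ∀ i n → H (+ i) n + H -[1+ i ] n ≡ 0ℤ
    cancels i n = trans (cong (_+_ (H (+ i) n)) (anti i n)) (ℤₚ.+-inverseʳ (H (+ i) n))
    paired : ∀ R → symSum R H ⊕ H -[1+ R ] ≗ 𝟘
    paired zero    = cancels 0
    paired (suc R) n = trans (regroup (symSum R H n) (H (+ suc R) n) (H -[1+ R ] n) (H -[1+ suc R ] n))
                             (cong₂ _+_ (paired R n) (cancels (suc R) n))


module GaussIdentity where

  open PowerSeries
  open SymmetricSums
  open import Data.Nat as ℕ using (zero; suc; _≤_; _<_; z≤n; s≤s; _∸_; _≤?_)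
  import Data.Nat.Properties as ℕₚ
  import Data.Nat.Tactic.RingSolver as ℕ-Solver
  open import Data.Integer using (ℤ; +_; -[1+_]; -_; ∣_∣)
  import Data.Integer.Properties as ℤₚ
  open import Data.Product using (_,_)
  open import Data.Sum using (_⊎_; inj₁; inj₂)
  open import Relation.Binary.PropositionalEquality
  open import Relation.Nullary using (yes; no)

  -- P n = 1/(q;q)_n and Q n = 1/(q²;q²)_n.
  P Q : ℕ → Series
  P = ∏geom (λ k → k)
  Q = ∏geom (λ k → suc (k ℕ.+ k))

  P-unfold : ∀ a → P (suc a) ≗ P a ⊕ shift (suc a) (P (suc a))
  P-unfold a = ⊛-geom-unfold a (P a)

  P-stable : ∀ {a} b → a ≤ b → P b ≈[ a ] P a
  P-stable b a≤b with ℕₚ.m≤n⇒m<n∨m≡n a≤b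
  ... | inj₂ refl = ≈[]-refl
  P-stable (suc b) _ | inj₁ (s≤s a≤b) = ≈[]-trans (≈[]-weaken a≤b P[1+b]≈P[b]) (P-stable b a≤b)
    where
    P[1+b]≈P[b] : P (suc b) ≈[ b ] P b
    P[1+b]≈P[b] = ≈[]-trans (⊛-cong[] ≈[]-refl (geom≈[]𝟙 b)) (≗⇒≈[] b (⊛-identityʳ (P b)))

  -- P⊖ N i = 1/(q;q)_(N-i), read as 𝟘 when i > N.
  P⊖ : ℕ → ℕ → Series
  P⊖ N       zero    = P N
  P⊖ zero    (suc i) = 𝟘
  P⊖ (suc N) (suc i) = P⊖ N i

  P⊖-unfold : ∀ N i → P⊖ N i ≗ P⊖ N (suc i) ⊕ shift (N ∸ i) (P⊖ N i)
  P⊖-unfold zero    zero    n = sym (ℤₚ.+-identityˡ _)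
  P⊖-unfold zero    (suc i) n = refl
  P⊖-unfold (suc N) zero      = P-unfold N
  P⊖-unfold (suc N) (suc i)   = P⊖-unfold N i

  P⊖-vanishes : ∀ N i → N < i → P⊖ N i ≗ 𝟘
  P⊖-vanishes zero    (suc i) _         = ≗-refl
  P⊖-vanishes (suc N) (suc i) (s≤s N<i) = P⊖-vanishes N i N<i

  P⊖≗P : ∀ N i → i ≤ N → P⊖ N i ≗ P (N ∸ i)
  P⊖≗P N       zero    _         = ≗-refl
  P⊖≗P (suc N) (suc i) (s≤s i≤N) = P⊖≗P N i i≤N

  -- P₊ N j = 1/(q;q)_(N+j) and P₋ N j = 1/(q;q)_(N-j), read as 𝟘 for negative indices.
  P₊ P₋ : ℕ → ℤ → Series
  P₊ N (+ i)    = P (N ℕ.+ i)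
  P₊ N -[1+ i ] = P⊖ N (suc i)
  P₋ N j = P₊ N (- j)

  P₋-nonneg : ∀ N i → P₋ N (+ i) ≗ P⊖ N i
  P₋-nonneg N zero rewrite ℕₚ.+-identityʳ N = ≗-refl
  P₋-nonneg N (suc i) = ≗-refl

  P₋-neg : ∀ N j → P₋ N (- j) ≗ P₊ N j
  P₋-neg N j rewrite ℤₚ.neg-involutive j = ≗-refl

  -- e₊ N j = N + 1 + j whenever that is ≥ 0.
  e₊ : ℕ → ℤ → ℕ
  e₊ N (+ i)    = suc (N ℕ.+ i)
  e₊ N -[1+ i ] = N ∸ i

  P₊-unfold : ∀ N j → P₊ (suc N) j ≗ P₊ N j ⊕ shift (e₊ N j) (P₊ (suc N) j)
  P₊-unfold N (+ i)    = P-unfold (N ℕ.+ i)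
  P₊-unfold N -[1+ i ] = P⊖-unfold N i

  P₋-unfold : ∀ N j → P₋ (suc N) j ≗ P₋ N j ⊕ shift (e₊ N (- j)) (P₋ (suc N) j)
  P₋-unfold N j = P₊-unfold N (- j)

  P₊-approx : ∀ N j → ∣ j ∣ ≤ N → P₊ N j ≈[ N ∸ ∣ j ∣ ] P N
  P₊-approx N (+ i)    _   = ≈[]-weaken (ℕₚ.m∸n≤m N i) (P-stable (N ℕ.+ i) (ℕₚ.m≤m+n N i))
  P₊-approx N -[1+ i ] i<N =
    ≈[]-trans (≗⇒≈[] _ (P⊖≗P N (suc i) i<N)) (≈[]-sym (P-stable N (ℕₚ.m∸n≤m N (suc i))))

  P₋-approx : ∀ N j → ∣ j ∣ ≤ N → P₋ N j ≈[ N ∸ ∣ j ∣ ] P N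
  P₋-approx N j rewrite sym (ℤₚ.∣-i∣≡∣i∣ j) = P₊-approx N (- j)

  P₊⊛P₋-vanishes : ∀ N j → N < ∣ j ∣ → P₊ N j ⊛ P₋ N j ≗ 𝟘
  P₊⊛P₋-vanishes N (+ suc i) N<i = ⊛-vanishesʳ (P (N ℕ.+ suc i)) (P⊖-vanishes N (suc i) N<i)
  P₊⊛P₋-vanishes N -[1+ i ]  N<i = ⊛-vanishesˡ (P (N ℕ.+ suc i)) (P⊖-vanishes N (suc i) N<i)

  -- (-1)^j, in terms of the sign sgn m = (-1)^(m+1) used by altSum.
  sign : ℤ → ℤ
  sign j = sgn (suc ∣ j ∣)

  sgn-suc : ∀ m → sgn (suc m) ≡ - sgn m
  sgn-suc zero          = refl
  sgn-suc (suc zero)    = refl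
  sgn-suc (suc (suc m)) = sgn-suc m

  sq : ℤ → ℕ
  sq j = ∣ j ∣ ℕ.* ∣ j ∣

  ∣j∣≤sq : ∀ j → ∣ j ∣ ≤ sq j
  ∣j∣≤sq j with ∣ j ∣
  ... | zero  = z≤n
  ... | suc k = ℕₚ.m≤m*n (suc k) (suc k)

  weigh : ℤ → Series → Series
  weigh j X = sign j · shift (sq j) X

  weigh-cong : ∀ j {X Y} → X ≗ Y → weigh j X ≗ weigh j Y
  weigh-cong j p = ·-cong (sign j) (shift-cong (sq j) p)

  weigh-⊕ : ∀ j X Y → weigh j (X ⊕ Y) ≗ weigh j X ⊕ weigh j Y
  weigh-⊕ j X Y = ≗-trans (·-cong (sign j) (shift-⊕ (sq j) X Y)) (·-distrib-⊕ (sign j) _ _)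

  weigh-neg : ∀ j X → weigh (- j) X ≗ weigh j X
  weigh-neg j X rewrite ℤₚ.∣-i∣≡∣i∣ j = ≗-refl

  weigh-small : ∀ j X {N} → N < sq j → weigh j X ≈[ N ] 𝟘
  weigh-small j X N<sq = ≈[]-trans (·-cong[] (sign j) (shift-small (sq j) X N<sq)) (≗⇒≈[] _ (·-zero (sign j)))

  ⊛-weighˡ : ∀ j X Y → weigh j X ⊛ Y ≗ weigh j (X ⊛ Y)
  ⊛-weighˡ j X Y = ≗-trans (⊛-·ˡ (sign j) _ Y) (·-cong (sign j) (⊛-shiftˡ (sq j) X Y))

  term : ℕ → ℤ → Series
  term N j = weigh j (P₊ N j ⊛ P₋ N j)

  term-vanishes : ∀ N j → N < ∣ j ∣ → term N j ≗ 𝟘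
  term-vanishes N j N<j = ≗-trans (weigh-cong j (P₊⊛P₋-vanishes N j N<j))
                                  (≗-trans (·-cong (sign j) (shift-𝟘 (sq j))) (·-zero (sign j)))

  term-approx : ∀ N j → term N j ≈[ N ] weigh j (P N ⊛ P N)
  term-approx N j with ∣ j ∣ ≤? N
  ... | yes j≤N =
    ·-cong[] (sign j) (≈[]-weaken N≤e (shift-cong[] (sq j) (⊛-cong[] (P₊-approx N j j≤N) (P₋-approx N j j≤N))))
    where
    N≤e : N ≤ sq j ℕ.+ (N ∸ ∣ j ∣)
    N≤e = ℕₚ.≤-trans (ℕₚ.≤-reflexive (sym (ℕₚ.m+[n∸m]≡n j≤N)))
                     (ℕₚ.+-monoˡ-≤ (N ∸ ∣ j ∣) (∣j∣≤sq j))
  ... | no j≰N = ≈[]-trans (≗⇒≈[] N (term-vanishes N j N<j))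
                           (≈[]-sym (weigh-small j (P N ⊛ P N) (ℕₚ.<-≤-trans N<j (∣j∣≤sq j))))
    where
    N<j : N < ∣ j ∣
    N<j = ℕₚ.≰⇒> j≰N

  weigh-shift : ∀ j c e′ {e} X → sq j ℕ.+ e ≡ c ℕ.+ e′ ⊎ X ≗ 𝟘 →
                weigh j (shift e X) ≗ shift c (sign j · shift e′ X)
  weigh-shift j c e′ {e} X cond = begin
    sign j · shift (sq j) (shift e X)  ≈⟨ ·-cong (sign j) (≗-sym (shift-+ (sq j) e X)) ⟩
    sign j · shift (sq j ℕ.+ e) X      ≈⟨ ·-cong (sign j) (shift-exponent X cond) ⟩
    sign j · shift (c ℕ.+ e′) X        ≈⟨ ·-cong (sign j) (shift-+ c e′ X) ⟩
    sign j · shift c (shift e′ X)      ≈⟨ ≗-sym (shift-· c (sign j) (shift e′ X)) ⟩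
    shift c (sign j · shift e′ X)      ∎
    where open ≗-Reasoning

  oblong : ℤ → ℕ
  oblong (+ i)    = i ℕ.* suc i
  oblong -[1+ i ] = suc i ℕ.* i

  oblongTerm : ℕ → ℤ → Series
  oblongTerm N j = sign j · shift (oblong j) (P₊ (suc N) j ⊛ P₋ N j)

  oblongTerm-antisym : ∀ N i n → oblongTerm N -[1+ i ] n ≡ - oblongTerm N (+ i) n
  oblongTerm-antisym N i n = begin
    sgn (suc (suc i)) * shift (suc i ℕ.* i) (P⊖ N i ⊛ P (N ℕ.+ suc i)) n
      ≡⟨ cong₂ _*_ (sgn-suc (suc i)) (cong (λ e → shift e X n) (ℕₚ.*-comm (suc i) i)) ⟩
    - sgn (suc i) * shift (i ℕ.* suc i) (P⊖ N i ⊛ P (N ℕ.+ suc i)) n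
      ≡⟨ cong (_*_ (- sgn (suc i))) (shift-cong (i ℕ.* suc i) factors n) ⟩
    - sgn (suc i) * shift (i ℕ.* suc i) (P (suc N ℕ.+ i) ⊛ P₋ N (+ i)) n
      ≡⟨ sym (ℤₚ.neg-distribˡ-* (sgn (suc i)) _) ⟩
    - oblongTerm N (+ i) n ∎
    where
    open ≡-Reasoning
    X : Series
    X = P⊖ N i ⊛ P (N ℕ.+ suc i)
    factors : X ≗ P (suc N ℕ.+ i) ⊛ P₋ N (+ i)
    factors rewrite ℕₚ.+-suc N i = ≗-trans (⊛-comm _ _) (⊛-cong ≗-refl (≗-sym (P₋-nonneg N i)))

  symSum-oblongTerm : ∀ N R → N < R → symSum R (oblongTerm N) ≗ 𝟘
  symSum-oblongTerm N R N<R = symSum-antisym R (oblongTerm N) (oblongTerm-antisym N) vanishes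
    where
    vanishes : oblongTerm N -[1+ R ] ≗ 𝟘
    vanishes = ≗-trans (·-cong s (≗-trans (shift-cong e factors≗𝟘) (shift-𝟘 e))) (·-zero s)
      where
      s : ℤ
      s = sign -[1+ R ]
      e : ℕ
      e = oblong -[1+ R ]
      factors≗𝟘 : P₊ (suc N) -[1+ R ] ⊛ P₋ N -[1+ R ] ≗ 𝟘
      factors≗𝟘 = ⊛-vanishesˡ (P (N ℕ.+ suc R)) (P⊖-vanishes N R N<R)

  private
    exponent-cross₊ : ∀ N i → i ℕ.* i ℕ.+ suc (N ℕ.+ i) ≡ suc N ℕ.+ i ℕ.* suc i
    exponent-cross₊ = ℕ-Solver.solve-∀
    exponent-cross₋ : ∀ i d → suc i ℕ.* suc i ℕ.+ d ≡ suc (i ℕ.+ d) ℕ.+ suc i ℕ.* i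
    exponent-cross₋ = ℕ-Solver.solve-∀
    exponent-doubly₀ : ∀ N → 0 ℕ.+ (suc (N ℕ.+ 0) ℕ.+ suc (N ℕ.+ 0)) ≡ suc (suc (N ℕ.+ N)) ℕ.+ 0
    exponent-doubly₀ = ℕ-Solver.solve-∀
    exponent-doubly₊ : ∀ k d → suc k ℕ.* suc k ℕ.+ (suc ((k ℕ.+ d) ℕ.+ suc k) ℕ.+ d)
                          ≡ suc (suc ((k ℕ.+ d) ℕ.+ (k ℕ.+ d))) ℕ.+ suc k ℕ.* suc k
    exponent-doubly₊ = ℕ-Solver.solve-∀
    exponent-doubly₋ : ∀ i d → suc i ℕ.* suc i ℕ.+ (d ℕ.+ suc ((i ℕ.+ d) ℕ.+ suc i))
                          ≡ suc (suc ((i ℕ.+ d) ℕ.+ (i ℕ.+ d))) ℕ.+ suc i ℕ.* suc i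
    exponent-doubly₋ = ℕ-Solver.solve-∀

  exponent-cross : ∀ N j → sq j ℕ.+ e₊ N j ≡ suc N ℕ.+ oblong j ⊎ P₊ (suc N) j ⊛ P₋ N j ≗ 𝟘
  exponent-cross N (+ i) = inj₁ (exponent-cross₊ N i)
  exponent-cross N -[1+ i ] with i ≤? N
  ... | no i≰N = inj₂ (⊛-vanishesˡ _ (P⊖-vanishes N i (ℕₚ.≰⇒> i≰N)))
  ... | yes i≤N with ℕₚ.m≤n⇒∃[o]m+o≡n i≤N
  ...   | d , refl rewrite ℕₚ.m+n∸m≡n i d = inj₁ (exponent-cross₋ i d)

  exponent-doubly : ∀ N j → sq j ℕ.+ (e₊ N j ℕ.+ e₊ N (- j)) ≡ suc (suc (N ℕ.+ N)) ℕ.+ sq j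
                       ⊎ P₊ (suc N) j ⊛ P₋ (suc N) j ≗ 𝟘
  exponent-doubly N (+ zero) = inj₁ (exponent-doubly₀ N)
  exponent-doubly N (+ suc k) with k ≤? N
  ... | no k≰N = inj₂ (⊛-vanishesʳ _ (P⊖-vanishes N k (ℕₚ.≰⇒> k≰N)))
  ... | yes k≤N with ℕₚ.m≤n⇒∃[o]m+o≡n k≤N
  ...   | d , refl rewrite ℕₚ.m+n∸m≡n k d = inj₁ (exponent-doubly₊ k d)
  exponent-doubly N -[1+ i ] with i ≤? N
  ... | no i≰N = inj₂ (⊛-vanishesˡ _ (P⊖-vanishes N i (ℕₚ.≰⇒> i≰N)))
  ... | yes i≤N with ℕₚ.m≤n⇒∃[o]m+o≡n i≤N
  ...   | d , refl rewrite ℕₚ.m+n∸m≡n i d = inj₁ (exponent-doubly₋ i d)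

  -- Expanding both factors of term (1+N) j by their recurrences leaves, besides term N j and
  -- q^(2N+2) term (1+N) j, two copies of q^(N+1) oblongTerm N j, whose sum over j vanishes.
  module _ (N : ℕ) where
    private
      lowered raised cross doubly : ℤ → Series
      lowered j = weigh j (P₊ N j ⊛ P₋ (suc N) j)
      raised  j = weigh j (shift (e₊ N j) (P₊ (suc N) j) ⊛ P₋ (suc N) j)
      cross   j = weigh j (shift (e₊ N j) (P₊ (suc N) j) ⊛ P₋ N j)
      doubly  j = weigh j (shift (e₊ N j) (P₊ (suc N) j) ⊛ shift (e₊ N (- j)) (P₋ (suc N) j))

      term-split : ∀ j → term (suc N) j ≗ lowered j ⊕ raised j
      term-split j = ≗-trans (weigh-cong j (≗-trans (⊛-cong (P₊-unfold N j) ≗-refl) (⊛-distribʳ-⊕ _ _ _)))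
                             (weigh-⊕ j _ _)

      lowered-reflect : ∀ j → lowered (- j) ≗ term N j ⊕ cross j
      lowered-reflect j = begin
        weigh (- j) (P₋ N j ⊛ P₋ (suc N) (- j))
          ≈⟨ weigh-neg j _ ⟩
        weigh j (P₋ N j ⊛ P₋ (suc N) (- j))
          ≈⟨ weigh-cong j (⊛-cong ≗-refl (P₋-neg (suc N) j)) ⟩
        weigh j (P₋ N j ⊛ P₊ (suc N) j)
          ≈⟨ weigh-cong j (⊛-comm _ _) ⟩
        weigh j (P₊ (suc N) j ⊛ P₋ N j)
          ≈⟨ weigh-cong j (⊛-cong (P₊-unfold N j) ≗-refl) ⟩
        weigh j ((P₊ N j ⊕ shift (e₊ N j) (P₊ (suc N) j)) ⊛ P₋ N j)
          ≈⟨ ≗-trans (weigh-cong j (⊛-distribʳ-⊕ _ _ _)) (weigh-⊕ j _ _) ⟩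
        term N j ⊕ cross j ∎
        where open ≗-Reasoning

      raised-split : ∀ j → raised j ≗ cross j ⊕ doubly j
      raised-split j = ≗-trans (weigh-cong j (≗-trans (⊛-cong ≗-refl (P₋-unfold N j)) (⊛-distribˡ-⊕ _ _ _)))
                               (weigh-⊕ j _ _)

      cross-shift : ∀ j → cross j ≗ shift (suc N) (oblongTerm N j)
      cross-shift j = ≗-trans (weigh-cong j (⊛-shiftˡ (e₊ N j) _ _))
                              (weigh-shift j (suc N) (oblong j) _ (exponent-cross N j))

      doubly-shift : ∀ j → doubly j ≗ shift (suc (suc (N ℕ.+ N))) (term (suc N) j)
      doubly-shift j = ≗-trans (weigh-cong j (shift-⊛-shift (e₊ N j) (e₊ N (- j)) _ _))
                               (weigh-shift j (suc (suc (N ℕ.+ N))) (sq j) _ (exponent-doubly N j))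

    gauss-step : ∀ R → N < R → let S M = symSum R (term M) in
                 S (suc N) ≗ S N ⊕ shift (suc (suc (N ℕ.+ N))) (S (suc N))
    gauss-step R N<R = begin
      symSum R (term (suc N))
        ≈⟨ ≗-trans (symSum-cong R term-split) (symSum-⊕ R lowered raised) ⟩
      symSum R lowered ⊕ symSum R raised
        ≈⟨ ⊕-cong (≗-trans (≗-sym (symSum-reflect R lowered)) (symSum-cong R lowered-reflect))
                  (symSum-cong R raised-split) ⟩
      symSum R (λ j → term N j ⊕ cross j) ⊕ symSum R (λ j → cross j ⊕ doubly j)
        ≈⟨ ⊕-cong (symSum-⊕ R (term N) cross) (symSum-⊕ R cross doubly) ⟩
      (symSum R (term N) ⊕ symSum R cross) ⊕ (symSum R cross ⊕ symSum R doubly)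
        ≈⟨ ⊕-cong (⊕-cong (≗-refl {symSum R (term N)}) Σcross≗𝟘) (⊕-cong Σcross≗𝟘 Σdoubly) ⟩
      (symSum R (term N) ⊕ 𝟘) ⊕ (𝟘 ⊕ shift c (symSum R (term (suc N))))
        ≈⟨ ⊕-cong (⊕-identityʳ (symSum R (term N))) (⊕-identityˡ (shift c (symSum R (term (suc N))))) ⟩
      symSum R (term N) ⊕ shift c (symSum R (term (suc N))) ∎
      where
      open ≗-Reasoning
      c : ℕ
      c = suc (suc (N ℕ.+ N))
      Σcross≗𝟘 : symSum R cross ≗ 𝟘
      Σcross≗𝟘 = ≗-trans (symSum-cong R cross-shift)
                   (≗-trans (symSum-shift R (suc N) (oblongTerm N))
                   (≗-trans (shift-cong (suc N) (symSum-oblongTerm N R N<R)) (shift-𝟘 (suc N))))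
      Σdoubly : symSum R doubly ≗ shift c (symSum R (term (suc N)))
      Σdoubly = ≗-trans (symSum-cong R doubly-shift) (symSum-shift R c (term (suc N)))

  gauss-finite : ∀ N R → N < R → symSum R (term N) ≗ Q N
  gauss-finite zero R _ = ≗-trans (symSum-central R (term 0) (term-vanishes 0)) term₀≗𝟙
    where
    term₀≗𝟙 : term 0 (+ 0) ≗ 𝟙
    term₀≗𝟙 n = trans (ℤₚ.*-identityˡ _) (⊛-identityˡ 𝟙 n)
  gauss-finite (suc N) R 1+N<R =
    ⊛-geom-unique (suc (N ℕ.+ N)) (≗-trans (gauss-step N R N<R) (⊕-cong (gauss-finite N R N<R) ≗-refl))
    where
    N<R : N < R
    N<R = ℕₚ.<-trans (ℕₚ.n<1+n N) 1+N<R

  Θ : ℕ → Series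
  Θ R = symSum R (λ j → weigh j 𝟙)

  Θ-⊛ : ∀ R F → Θ R ⊛ F ≗ symSum R (λ j → weigh j F)
  Θ-⊛ R F = ≗-trans (⊛-symSumˡ R _ F)
                     (symSum-cong R (λ j → ≗-trans (⊛-weighˡ j 𝟙 F) (weigh-cong j (⊛-identityˡ F))))

  Θ⊛P⊛P≈[]Q : ∀ N → Θ (suc N) ⊛ (P N ⊛ P N) ≈[ N ] Q N
  Θ⊛P⊛P≈[]Q N = begin
    Θ (suc N) ⊛ (P N ⊛ P N)                     ≈⟨ ≗⇒≈[] N (Θ-⊛ (suc N) (P N ⊛ P N)) ⟩
    symSum (suc N) (λ j → weigh j (P N ⊛ P N))  ≈⟨ symSum-cong[] (suc N) (λ j → ≈[]-sym (term-approx N j)) ⟩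
    symSum (suc N) (term N)                     ≈⟨ ≗⇒≈[] N (gauss-finite N (suc N) (ℕₚ.n<1+n N)) ⟩
    Q N                                         ∎
    where open ≈[]-Reasoning N


module BoundedLists where

  open import Data.Nat using (zero; suc; _≤_; s≤s)
  import Data.Nat.Properties as ℕₚ
  open import Data.List using (List; []; _∷_; length; map; upTo)
  import Data.List.Properties as Listₚ
  open import Data.List.Membership.Propositional using (_∈_)
  open import Data.List.Membership.Propositional.Properties
  open import Data.List.Membership.Propositional.Properties.WithK using (unique∧set⇒bag)
  open import Data.List.Relation.Unary.Any using (here)
  import Data.List.Relation.Unary.Any as Any
  open import Data.List.Relation.Unary.All using (All; []; _∷_)
  import Data.List.Relation.Unary.All as All
  import Data.List.Relation.Unary.All.Properties as Allₚ
  open import Data.List.Relation.Unary.AllPairs using ([]; _∷_)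
  import Data.List.Relation.Unary.AllPairs as AllPairs
  import Data.List.Relation.Unary.AllPairs.Properties as AllPairsₚ
  open import Data.List.Relation.Unary.Unique.Propositional using (Unique)
  import Data.List.Relation.Unary.Unique.Propositional.Properties as Uniqueₚ
  open import Data.List.Relation.Binary.BagAndSetEquality using (_∼[_]_; set; ∼bag⇒↭)
  open import Data.List.Relation.Binary.Permutation.Propositional.Properties using (↭-length)
  open import Data.List.Relation.Binary.Disjoint.Propositional using (Disjoint)
  open import Data.Product using (_,_)
  open import Data.Sum using (inj₁; inj₂)
  open import Relation.Binary.PropositionalEquality

  ∈-listsOfLength⁻ : ∀ b k {v} → v ∈ listsOfLength b k → length v ≡ k
  ∈-listsOfLength⁻ b zero    (here refl) = refl
  ∈-listsOfLength⁻ b (suc k) v∈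
    with Any.satisfied (∈-concatMap⁻ (λ x → map (x ∷_) (listsOfLength b k)) {xs = upTo (suc b)} v∈)
  ... | x , v∈x∷ with ∈-map⁻ (x ∷_) v∈x∷
  ...   | v′ , v′∈ , refl = cong suc (∈-listsOfLength⁻ b k v′∈)

  ∈-listsUpTo⁻ : ∀ b L {v} → v ∈ listsUpTo b L → length v ≤ L
  ∈-listsUpTo⁻ b zero    v∈ = ℕₚ.≤-reflexive (∈-listsOfLength⁻ b zero v∈)
  ∈-listsUpTo⁻ b (suc L) v∈ with ∈-++⁻ (listsUpTo b L) v∈
  ... | inj₁ v∈ˡ = ℕₚ.m≤n⇒m≤1+n (∈-listsUpTo⁻ b L v∈ˡ)
  ... | inj₂ v∈ʳ = ℕₚ.≤-reflexive (∈-listsOfLength⁻ b (suc L) v∈ʳ)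

  ∈-listsOfLength⁺ : ∀ b l → All (_≤ b) l → l ∈ listsOfLength b (length l)
  ∈-listsOfLength⁺ b []      _          = here refl
  ∈-listsOfLength⁺ b (x ∷ l) (x≤b ∷ l≤b) =
    ∈-concatMap⁺ (λ y → map (y ∷_) (listsOfLength b (length l)))
      (Any.map (λ { refl → ∈-map⁺ (x ∷_) (∈-listsOfLength⁺ b l l≤b) }) (∈-upTo⁺ (s≤s x≤b)))

  ∈-listsUpTo⁺ : ∀ b L l → length l ≤ L → All (_≤ b) l → l ∈ listsUpTo b L
  ∈-listsUpTo⁺ b zero    []  _     _   = here refl
  ∈-listsUpTo⁺ b (suc L) l l≤1+L l≤b with ℕₚ.m≤n⇒m<n∨m≡n l≤1+L
  ... | inj₁ (s≤s l≤L) = ∈-++⁺ˡ (∈-listsUpTo⁺ b L l l≤L l≤b)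
  ... | inj₂ l≡1+L     =
    ∈-++⁺ʳ (listsUpTo b L) (subst (λ k → l ∈ listsOfLength b k) l≡1+L (∈-listsOfLength⁺ b l l≤b))

  listsOfLength-unique : ∀ b k → Unique (listsOfLength b k)
  listsOfLength-unique b zero    = [] ∷ []
  listsOfLength-unique b (suc k) =
    Uniqueₚ.concat⁺
      (Allₚ.map⁺ (All.tabulate (λ _ → Uniqueₚ.map⁺ Listₚ.∷-injectiveʳ (listsOfLength-unique b k))))
      (AllPairsₚ.map⁺ (AllPairs.map disjoint (Uniqueₚ.upTo⁺ (suc b))))
    where
    disjoint : ∀ {x y} → x ≢ y → Disjoint (map (x ∷_) (listsOfLength b k)) (map (y ∷_) (listsOfLength b k))
    disjoint x≢y (v∈x∷ , v∈y∷) with ∈-map⁻ _ v∈x∷ | ∈-map⁻ _ v∈y∷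
    ... | _ , _ , refl | _ , _ , eq = x≢y (Listₚ.∷-injectiveˡ eq)

  listsUpTo-unique : ∀ b L → Unique (listsUpTo b L)
  listsUpTo-unique b zero    = listsOfLength-unique b zero
  listsUpTo-unique b (suc L) = Uniqueₚ.++⁺ (listsUpTo-unique b L) (listsOfLength-unique b (suc L)) disjoint
    where
    disjoint : Disjoint (listsUpTo b L) (listsOfLength b (suc L))
    disjoint (v∈ˡ , v∈ʳ) = ℕₚ.<-irrefl (∈-listsOfLength⁻ b (suc L) v∈ʳ) (s≤s (∈-listsUpTo⁻ b L v∈ˡ))

  length-unique-set : ∀ {A : Set} {xs ys : List A} →
                      Unique xs → Unique ys → xs ∼[ set ] ys → length xs ≡ length ys
  length-unique-set xs! ys! xs∼ys = ↭-length (∼bag⇒↭ (unique∧set⇒bag xs! ys! xs∼ys))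


module JaggedPartitions where

  open PowerSeries
  open GaussIdentity using (P)
  open import Data.Nat as ℕ using (zero; suc; pred; _+_; _≤_; _<_; z≤n; s≤s; _∸_; _≤?_)
  import Data.Nat.Properties as ℕₚ
  open import Data.Nat.ListAction using (sum)
  open BoundedLists
  open import Data.List using (List; []; _∷_; length; map; filter; _++_)
  import Data.List.Properties as Listₚ
  open import Data.Integer as ℤ using ()
  open import Data.List.Membership.Propositional using (_∈_)
  open import Data.List.Membership.Propositional.Properties
    using (∈-++⁻; ∈-++⁺ˡ; ∈-++⁺ʳ; ∈-map⁻; ∈-map⁺; ∈-filter⁺; ∈-filter⁻)
  open import Data.List.Relation.Binary.BagAndSetEquality using (_∼[_]_; set)
  open import Function.Bundles using (mk⇔)
  open import Data.List.Relation.Unary.Any using (here)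
  open import Data.List.Relation.Unary.All using (All; []; _∷_)
  import Data.List.Relation.Unary.All as All
  open import Data.List.Relation.Unary.AllPairs using ([]; _∷_)
  open import Data.List.Relation.Unary.Unique.Propositional using (Unique)
  import Data.List.Relation.Unary.Unique.Propositional.Properties as Uniqueₚ
  open import Data.List.Relation.Binary.Disjoint.Propositional using (Disjoint)
  open import Data.Nat.ListAction.Properties using (sum-++)
  import Data.Nat.Tactic.RingSolver as ℕ-Solver
  open import Data.Product using (_×_; _,_; proj₁; proj₂; ∃)
  import Data.Product as Product
  open import Data.Sum using (inj₁; inj₂)
  open import Data.Unit using (tt)
  open import Relation.Binary.PropositionalEquality hiding (J)
  open import Relation.Nullary using (yes; no; ¬_)
  open import Data.Empty using (⊥-elim)

  -- block (2u) = [u] and block (2u+1) = [u, u+1]; block 0 is never used.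
  block : ℕ → List ℕ
  block zero          = 0 ∷ []
  block (suc zero)    = 0 ∷ 1 ∷ []
  block (suc (suc K)) = map suc (block K)

  data Parity : ℕ → Set where
    even : ∀ u → Parity (u + u)
    odd  : ∀ u → Parity (suc (u + u))

  parity : ∀ K → Parity K
  parity zero = even 0
  parity (suc K) with parity K
  ... | even u = odd u
  ... | odd  u = subst Parity (cong suc (ℕₚ.+-suc u u)) (even (suc u))

  block-even : ∀ u → block (u + u) ≡ u ∷ []
  block-even zero    = refl
  block-even (suc u) rewrite ℕₚ.+-suc u u | block-even u = refl

  block-odd : ∀ u → block (suc (u + u)) ≡ u ∷ suc u ∷ []
  block-odd zero    = refl
  block-odd (suc u) rewrite ℕₚ.+-suc u u | block-odd u = refl

  weight : ℕ → ℕ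
  weight K = sum (block K)

  -- J L = ∏_{1 ≤ K ≤ L} 1/(1 - q^(weight K)) counts the 01-partitions with leading block ≤ L.
  J : ℕ → Series
  J = ∏geom (λ K → pred (weight (suc K)))

  J-even : ∀ N → J (N + N) ≗ ∏geom (λ k → k + k) N ⊛ P N
  J-even N = ≗-trans (∏geom-split _ N) (⊛-cong (∏geom-cong odd-block N) (∏geom-cong even-block N))
    where
    odd-block : ∀ k → pred (weight (suc (k + k))) ≡ k + k
    odd-block k rewrite block-odd k | ℕₚ.+-identityʳ k = cong pred (ℕₚ.+-suc k k)
    even-block : ∀ k → pred (weight (suc (suc (k + k)))) ≡ k
    even-block k rewrite block-even k = ℕₚ.+-identityʳ k

  leadingBlock : List ℕ → ℕ
  leadingBlock []          = 0
  leadingBlock (a ∷ [])    = a + a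
  leadingBlock (a ∷ b ∷ _) with b ℕ.≟ suc a
  ... | yes _ = suc (a + a)
  ... | no  _ = a + a

  private
    half-≤ : ∀ {c d} → c + c ≤ d + d → c ≤ d
    half-≤ p = ℕₚ.≮⇒≥ (λ d<c → ℕₚ.<⇒≱ (ℕₚ.+-mono-< d<c d<c) p)

    half-≤-odd : ∀ {c d} → c + c ≤ suc (d + d) → c ≤ d
    half-≤-odd {c} {d} p =
      ℕₚ.≮⇒≥ (λ d<c → ℕₚ.<⇒≱ (ℕₚ.<-≤-trans d+d<1+d+1+d (ℕₚ.+-mono-≤ d<c d<c)) p)
      where
      d+d<1+d+1+d : suc (d + d) < suc d + suc d
      d+d<1+d+1+d = s≤s (ℕₚ.+-monoʳ-< d (ℕₚ.n<1+n d))

    ≤+1∧≢⇒≤ : ∀ {d c} → d ≤ c + 1 → d ≢ suc c → d ≤ c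
    ≤+1∧≢⇒≤ {d} {c} d≤c+1 d≢1+c =
      ℕₚ.≤-pred (ℕₚ.≤∧≢⇒< (subst (d ≤_) (ℕₚ.+-comm c 1) d≤c+1) d≢1+c)

  Jagged-tail : ∀ a l → Jagged (a ∷ l) → Jagged l
  Jagged-tail a []          _           = tt
  Jagged-tail a (b ∷ [])    (_ , jag)     = jag
  Jagged-tail a (b ∷ c ∷ r) (_ , _ , jag) = jag

  Jagged-rise : ∀ a b r → Jagged (a ∷ b ∷ r) → b ≤ a + 1
  Jagged-rise a b []      (b≤a+1 , _) = b≤a+1
  Jagged-rise a b (c ∷ r) (b≤a+1 , _) = b≤a+1

  ¬Jagged-00 : ∀ r → ¬ Jagged (0 ∷ 0 ∷ r)
  ¬Jagged-00 []      (_ , ())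
  ¬Jagged-00 (c ∷ r) (_ , z≤n , jag) = ¬Jagged-00 r jag

  leadingBlock-≥ : ∀ c r → c + c ≤ leadingBlock (c ∷ r)
  leadingBlock-≥ c []      = ℕₚ.≤-refl
  leadingBlock-≥ c (d ∷ r) with d ℕ.≟ suc c
  ... | yes _ = ℕₚ.n≤1+n (c + c)
  ... | no  _ = ℕₚ.≤-refl

  leadingBlock-≤ : ∀ c r → leadingBlock (c ∷ r) ≤ suc (c + c)
  leadingBlock-≤ c []      = ℕₚ.n≤1+n (c + c)
  leadingBlock-≤ c (d ∷ r) with d ℕ.≟ suc c
  ... | yes _ = ℕₚ.≤-refl
  ... | no  _ = ℕₚ.n≤1+n (c + c)

  second-≤ : ∀ c d r → Jagged (c ∷ d ∷ r) → d + d ≤ suc (leadingBlock (c ∷ d ∷ r))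
  second-≤ c d r jag with d ℕ.≟ suc c
  ... | yes refl = ℕₚ.≤-reflexive (ℕₚ.+-suc (suc c) c)
  ... | no  d≢1+c = ℕₚ.m≤n⇒m≤1+n (ℕₚ.+-mono-≤ d≤c d≤c)
    where
    d≤c : d ≤ c
    d≤c = ≤+1∧≢⇒≤ (Jagged-rise c d r jag) d≢1+c

  leadingBlock-single : ∀ u c r → c ≤ u → leadingBlock (u ∷ c ∷ r) ≡ u + u
  leadingBlock-single u c r c≤u with c ℕ.≟ suc u
  ... | yes refl = ⊥-elim (ℕₚ.<-irrefl refl c≤u)
  ... | no  _    = refl

  leadingBlock-pair : ∀ a r → leadingBlock (a ∷ suc a ∷ r) ≡ suc (a + a)
  leadingBlock-pair a r with suc a ℕ.≟ suc a
  ... | yes _  = refl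
  ... | no  ≢a = ⊥-elim (≢a refl)

  private
    head-≤ : ∀ c r {K} → leadingBlock (c ∷ r) ≤ K → c + c ≤ K
    head-≤ c r lead≤K = ℕₚ.≤-trans (leadingBlock-≥ c r) lead≤K

  prepend-single : ∀ u l → 1 ≤ u → Jagged l → leadingBlock l ≤ u + u →
                   Jagged (u ∷ l) × leadingBlock (u ∷ l) ≡ u + u
  prepend-single u []          1≤u _ _     = 1≤u , refl
  prepend-single u (c ∷ [])    1≤u jag lead≤ =
    (ℕₚ.m≤n⇒m≤n+o 1 c≤u , jag) , leadingBlock-single u c [] c≤u
    where
    c≤u : c ≤ u
    c≤u = half-≤ (head-≤ c [] lead≤)
  prepend-single u (c ∷ d ∷ r) 1≤u jag lead≤ =
    (ℕₚ.m≤n⇒m≤n+o 1 c≤u , d≤u , jag) , leadingBlock-single u c (d ∷ r) c≤u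
    where
    c≤u : c ≤ u
    c≤u = half-≤ (head-≤ c (d ∷ r) lead≤)
    d≤u : d ≤ u
    d≤u = half-≤-odd (ℕₚ.≤-trans (second-≤ c d r jag) (s≤s lead≤))

  prepend-pair : ∀ a l → Jagged l → leadingBlock l ≤ suc (a + a) →
                 Jagged (a ∷ suc a ∷ l) × leadingBlock (a ∷ suc a ∷ l) ≡ suc (a + a)
  prepend-pair a []          _ _     = (ℕₚ.m<m+n a (s≤s z≤n) , s≤s z≤n) , leadingBlock-pair a []
  prepend-pair a (c ∷ [])    jag lead≤ =
    (ℕₚ.m<m+n a (s≤s z≤n) , c≤a , ℕₚ.m≤n⇒m≤n+o 1 (ℕₚ.m≤n⇒m≤1+n c≤a) , jag) ,
    leadingBlock-pair a (c ∷ [])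
    where
    c≤a : c ≤ a
    c≤a = half-≤-odd (head-≤ c [] lead≤)
  prepend-pair a (c ∷ d ∷ r) jag lead≤ =
    (ℕₚ.m<m+n a (s≤s z≤n) , c≤a , ℕₚ.m≤n⇒m≤n+o 1 (ℕₚ.m≤n⇒m≤1+n c≤a) , d≤1+a , jag) ,
    leadingBlock-pair a (c ∷ d ∷ r)
    where
    c≤a : c ≤ a
    c≤a = half-≤-odd (head-≤ c (d ∷ r) lead≤)
    d≤1+a : d ≤ suc a
    d≤1+a = half-≤ (ℕₚ.≤-trans (second-≤ c d r jag)
                               (ℕₚ.≤-trans (s≤s lead≤) (ℕₚ.≤-reflexive (cong suc (sym (ℕₚ.+-suc a a))))))

  prepend-block : ∀ K l → 1 ≤ K → Jagged l → leadingBlock l ≤ K →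
                  Jagged (block K ++ l) × leadingBlock (block K ++ l) ≡ K
  prepend-block K l 1≤K jag lead≤ with parity K
  ... | even u rewrite block-even u = prepend-single u l (half-positive 1≤K) jag lead≤
    where
    half-positive : ∀ {u} → 1 ≤ u + u → 1 ≤ u
    half-positive {suc u} _ = s≤s z≤n
  ... | odd  u rewrite block-odd  u = prepend-pair u l jag lead≤

  split-leading : ∀ x r → Jagged (x ∷ r) → let K = leadingBlock (x ∷ r) in
                  ∃ λ l′ → x ∷ r ≡ block K ++ l′ × Jagged l′ × leadingBlock l′ ≤ K
  split-leading x []      _ rewrite block-even x = [] , refl , tt , z≤n
  split-leading x (y ∷ r) jag with y ℕ.≟ suc x
  ... | yes refl rewrite block-odd x = r , refl , Jagged-tail (suc x) r (Jagged-tail x (suc x ∷ r) jag) , rest≤ r jag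
    where
    rest≤ : ∀ r → Jagged (x ∷ suc x ∷ r) → leadingBlock r ≤ suc (x + x)
    rest≤ []       _ = z≤n
    rest≤ (c ∷ r′) jag = ℕₚ.≤-trans (leadingBlock-≤ c r′) (s≤s (ℕₚ.+-mono-≤ c≤x c≤x))
      where
      c≤x : c ≤ x
      c≤x = proj₁ (proj₂ jag)
  ... | no y≢1+x rewrite block-even x = y ∷ r , refl , Jagged-tail x (y ∷ r) jag , rest≤ r jag
    where
    y≤x : y ≤ x
    y≤x = ≤+1∧≢⇒≤ (Jagged-rise x y r jag) y≢1+x
    rest≤ : ∀ r → Jagged (x ∷ y ∷ r) → leadingBlock (y ∷ r) ≤ x + x
    rest≤ []       _ = ℕₚ.+-mono-≤ y≤x y≤x
    rest≤ (d ∷ r′) jag with d ℕ.≟ suc y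
    ... | yes refl = ℕₚ.+-mono-< y<x y<x
      where
      y<x : y < x
      y<x = proj₁ (proj₂ jag)
    ... | no  _    = ℕₚ.+-mono-≤ y≤x y≤x

  leadingBlock-positive : ∀ x r → Jagged (x ∷ r) → 1 ≤ leadingBlock (x ∷ r)
  leadingBlock-positive (suc x) r       _ = ℕₚ.≤-trans (s≤s z≤n) (leadingBlock-≥ (suc x) r)
  leadingBlock-positive zero    []      ()
  leadingBlock-positive zero    (y ∷ r) jag with y ℕ.≟ 1
  ... | yes _  = s≤s z≤n
  ... | no y≢1 with ≤+1∧≢⇒≤ (Jagged-rise 0 y r jag) y≢1
  ...   | z≤n = ⊥-elim (¬Jagged-00 r jag)

  leadingBlock≤2sum : ∀ l → leadingBlock l ≤ sum l + sum l
  leadingBlock≤2sum []          = z≤n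
  leadingBlock≤2sum (a ∷ [])    = ℕₚ.+-mono-≤ (ℕₚ.m≤m+n a 0) (ℕₚ.m≤m+n a 0)
  leadingBlock≤2sum (a ∷ b ∷ r) with b ℕ.≟ suc a
  ... | yes refl = begin
    suc (a + a)                  ≡⟨ ℕₚ.+-suc a a ⟨
    a + suc a                    ≤⟨ ℕₚ.+-monoʳ-≤ a (ℕₚ.m≤m+n (suc a) (sum r)) ⟩
    a + (suc a + sum r)          ≤⟨ ℕₚ.m≤m+n _ _ ⟩
    sum (a ∷ suc a ∷ r) + sum (a ∷ suc a ∷ r) ∎
    where open ℕₚ.≤-Reasoning
  ... | no _ = ℕₚ.+-mono-≤ (ℕₚ.m≤m+n a _) (ℕₚ.m≤m+n a _)

  Jagged-pair-positive : ∀ a b r → Jagged (a ∷ b ∷ r) → 1 ≤ a + b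
  Jagged-pair-positive (suc _) _       _ _ = s≤s z≤n
  Jagged-pair-positive zero    (suc _) _ _ = s≤s z≤n
  Jagged-pair-positive zero    zero    r jag = ⊥-elim (¬Jagged-00 r jag)

  length≤2sum : ∀ l → Jagged l → length l ≤ sum l + sum l
  length≤2sum []          _   = z≤n
  length≤2sum (a ∷ [])    1≤a =
    ℕₚ.≤-trans 1≤a (ℕₚ.≤-trans (ℕₚ.m≤m+n a 0) (ℕₚ.m≤m+n (a + 0) (a + 0)))
  length≤2sum (a ∷ b ∷ r) jag   = subst (length (a ∷ b ∷ r) ≤_) (sym (regroup a b (sum r)))
    (ℕₚ.+-mono-≤ (ℕₚ.+-mono-≤ 1≤a+b 1≤a+b) (length≤2sum r (Jagged-tail b r (Jagged-tail a (b ∷ r) jag))))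
    where
    regroup : ∀ a b s → (a + (b + s)) + (a + (b + s)) ≡ ((a + b) + (a + b)) + (s + s)
    regroup = ℕ-Solver.solve-∀
    1≤a+b : 1 ≤ a + b
    1≤a+b = Jagged-pair-positive a b r jag

  All≤sum : ∀ l → All (_≤ sum l) l
  All≤sum []      = []
  All≤sum (x ∷ l) =
    ℕₚ.m≤m+n x (sum l) ∷ All.map (λ y≤ → ℕₚ.≤-trans y≤ (ℕₚ.m≤n+m (sum l) x)) (All≤sum l)

  weight-positive : ∀ L → 1 ≤ weight (suc L)
  weight-positive L = go (suc L) (s≤s z≤n)
    where
    go : ∀ K → 1 ≤ K → 1 ≤ weight K
    go K 1≤K with parity K
    go _ ()  | even zero
    go _ _   | even (suc u) rewrite block-even (suc u) = s≤s z≤n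
    go _ _   | odd u        rewrite block-odd u        = ℕₚ.m≤n⇒m≤o+n u (s≤s z≤n)

  J-unfold : ∀ L → J (suc L) ≗ J L ⊕ shift (weight (suc L)) (J (suc L))
  J-unfold L = ≗-trans (⊛-geom-unfold _ (J L))
                       (⊕-cong (≗-refl {J L}) (λ n → cong (λ e → shift e (J (suc L)) n) 1+pred[w]≡w))
    where
    1+pred[w]≡w : suc (pred (weight (suc L))) ≡ weight (suc L)
    1+pred[w]≡w = ℕₚ.suc-pred (weight (suc L)) {{ℕ.>-nonZero (weight-positive L)}}

  -- enum≤ f L n lists the 01-partitions of n with leading block ≤ L, and enum≡ f L n
  -- those with leading block exactly 1+L; the fuel f ≥ n only makes the recursion structural.
  enum≤ enum≡ : ℕ → ℕ → ℕ → List (List ℕ)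
  enum≤ f zero    zero    = [] ∷ []
  enum≤ f zero    (suc n) = []
  enum≤ f (suc L) n       = enum≤ f L n ++ enum≡ f L n

  enum≡ zero    L n = []
  enum≡ (suc f) L n with weight (suc L) ≤? n
  ... | yes _ = map (block (suc L) ++_) (enum≤ f (suc L) (n ∸ weight (suc L)))
  ... | no  _ = []

  private
    fuel-∸ : ∀ {n f w} → n ≤ suc f → 1 ≤ w → n ∸ w ≤ f
    fuel-∸ {n} n≤1+f 1≤w = ℕₚ.≤-trans (ℕₚ.∸-monoʳ-≤ n 1≤w) (ℕₚ.pred-mono-≤ n≤1+f)

  length-enum≤ : ∀ f L n → n ≤ f → + length (enum≤ f L n) ≡ J L n
  length-enum≡ : ∀ f L n → n ≤ f → + length (enum≡ f L n) ≡ shift (weight (suc L)) (J (suc L)) n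

  length-enum≤ f zero    zero    _   = refl
  length-enum≤ f zero    (suc n) _   = refl
  length-enum≤ f (suc L) n       n≤f = begin
    + length (enum≤ f L n ++ enum≡ f L n)
      ≡⟨ cong +_ (Listₚ.length-++ (enum≤ f L n)) ⟩
    + length (enum≤ f L n) ℤ.+ + length (enum≡ f L n)
      ≡⟨ cong₂ ℤ._+_ (length-enum≤ f L n n≤f) (length-enum≡ f L n n≤f) ⟩
    J L n ℤ.+ shift (weight (suc L)) (J (suc L)) n
      ≡⟨ J-unfold L n ⟨
    J (suc L) n ∎
    where open ≡-Reasoning

  length-enum≡ zero    L _ z≤n = sym (shift-below (weight (suc L)) _ (weight-positive L))
  length-enum≡ (suc f) L n n≤1+f with weight (suc L) ≤? n
  ... | yes w≤n = trans (cong +_ (Listₚ.length-map (block (suc L) ++_) (enum≤ f (suc L) (n ∸ weight (suc L)))))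
                        (trans (length-enum≤ f (suc L) _ (fuel-∸ n≤1+f (weight-positive L)))
                               (sym (shift-at (weight (suc L)) (J (suc L)) w≤n)))
  ... | no  w≰n = sym (shift-below (weight (suc L)) _ (ℕₚ.≰⇒> w≰n))

  enum≤-sound : ∀ f L n l → l ∈ enum≤ f L n → Is01Partition n l × leadingBlock l ≤ L
  enum≡-sound : ∀ f L n l → l ∈ enum≡ f L n → Is01Partition n l × leadingBlock l ≡ suc L

  enum≤-sound f zero    zero []  (here refl) = (refl , tt) , z≤n
  enum≤-sound f (suc L) n l l∈ with ∈-++⁻ (enum≤ f L n) l∈
  ... | inj₁ l∈≤ = Product.map₂ ℕₚ.m≤n⇒m≤1+n (enum≤-sound f L n l l∈≤)
  ... | inj₂ l∈≡ = Product.map₂ ℕₚ.≤-reflexive (enum≡-sound f L n l l∈≡)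

  enum≡-sound (suc f) L n l l∈ with weight (suc L) ≤? n
  ... | yes w≤n with ∈-map⁻ (block (suc L) ++_) l∈
  ...   | l′ , l′∈ , refl with enum≤-sound f (suc L) (n ∸ weight (suc L)) l′ l′∈
  ...     | (sum≡ , jag) , lead≤ with prepend-block (suc L) l′ (s≤s z≤n) jag lead≤
  ...       | jag⁺ , lead≡ = (sum≡n , jag⁺) , lead≡
    where
    sum≡n : sum (block (suc L) ++ l′) ≡ n
    sum≡n = trans (sum-++ (block (suc L)) l′) (trans (cong (_+_ (weight (suc L))) sum≡) (ℕₚ.m+[n∸m]≡n w≤n))

  enum≤-complete : ∀ f L n l → Is01Partition n l → leadingBlock l ≤ L → n ≤ f → l ∈ enum≤ f L n
  enum≡-complete : ∀ f L n l → Is01Partition n l → leadingBlock l ≡ suc L → n ≤ f → l ∈ enum≡ f L n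

  enum≤-complete f zero    .0 []      (refl , _) _    _ = here refl
  enum≤-complete f zero    n  (x ∷ r) (_ , jag) lead≤0 _ =
    ⊥-elim (ℕₚ.<⇒≱ (leadingBlock-positive x r jag) lead≤0)
  enum≤-complete f (suc L) n  l       p lead≤ n≤f with ℕₚ.m≤n⇒m<n∨m≡n lead≤
  ... | inj₁ (s≤s lead≤L) = ∈-++⁺ˡ (enum≤-complete f L n l p lead≤L n≤f)
  ... | inj₂ lead≡        = ∈-++⁺ʳ (enum≤ f L n) (enum≡-complete f L n l p lead≡ n≤f)

  enum≡-complete f L n (x ∷ r) (sum≡n , jag) lead≡ n≤f with split-leading x r jag
  ... | l′ , x∷r≡ , jag′ , lead′≤lead = subst (_∈ enum≡ f L n) (sym x∷r≡block++l′) (go f n≤f)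
    where
    x∷r≡block++l′ : x ∷ r ≡ block (suc L) ++ l′
    x∷r≡block++l′ = subst (λ K → x ∷ r ≡ block K ++ l′) lead≡ x∷r≡
    lead′≤ : leadingBlock l′ ≤ suc L
    lead′≤ = subst (leadingBlock l′ ≤_) lead≡ lead′≤lead
    sum-l : weight (suc L) + sum l′ ≡ n
    sum-l = trans (sym (sum-++ (block (suc L)) l′)) (trans (cong sum (sym x∷r≡block++l′)) sum≡n)
    w≤n : weight (suc L) ≤ n
    w≤n = subst (weight (suc L) ≤_) sum-l (ℕₚ.m≤m+n _ _)
    sum-l′ : sum l′ ≡ n ∸ weight (suc L)
    sum-l′ = trans (sym (ℕₚ.m+n∸m≡n (weight (suc L)) (sum l′))) (cong (_∸ weight (suc L)) sum-l)
    go : ∀ f → n ≤ f → block (suc L) ++ l′ ∈ enum≡ f L n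
    go zero    n≤0   = ⊥-elim (ℕₚ.<⇒≱ (ℕₚ.≤-trans (weight-positive L) w≤n) n≤0)
    go (suc f) n≤1+f with weight (suc L) ≤? n
    ... | yes _   = ∈-map⁺ (block (suc L) ++_)
                      (enum≤-complete f (suc L) _ l′ (sum-l′ , jag′) lead′≤ (fuel-∸ n≤1+f (weight-positive L)))
    ... | no  w≰n = ⊥-elim (w≰n w≤n)

  enum≤-unique : ∀ f L n → Unique (enum≤ f L n)
  enum≡-unique : ∀ f L n → Unique (enum≡ f L n)

  enum≤-unique f zero    zero    = [] ∷ []
  enum≤-unique f zero    (suc n) = []
  enum≤-unique f (suc L) n       = Uniqueₚ.++⁺ (enum≤-unique f L n) (enum≡-unique f L n) disjoint
    where
    disjoint : Disjoint (enum≤ f L n) (enum≡ f L n)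
    disjoint (v∈≤ , v∈≡) =
      ℕₚ.<-irrefl (proj₂ (enum≡-sound f L n _ v∈≡)) (s≤s (proj₂ (enum≤-sound f L n _ v∈≤)))

  enum≡-unique zero    L n = []
  enum≡-unique (suc f) L n with weight (suc L) ≤? n
  ... | yes _ = Uniqueₚ.map⁺ (Listₚ.++-cancelˡ (block (suc L)) _ _) (enum≤-unique f (suc L) (n ∸ weight (suc L)))
  ... | no  _ = []

  J-counts : ∀ L k → k + k ≤ L → J L k ≡ + j k
  J-counts L k 2k≤L = begin
    J L k                   ≡⟨ length-enum≤ k L k ℕₚ.≤-refl ⟨
    + length (enum≤ k L k)  ≡⟨ cong +_ (length-unique-set (enum≤-unique k L k) filter-unique same-members) ⟩
    + j k                   ∎
    where
    open ≡-Reasoning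
    space : List (List ℕ)
    space = listsUpTo k (2 ℕ.* k)
    filter-unique : Unique (filter (is01Partition? k) space)
    filter-unique = Uniqueₚ.filter⁺ (is01Partition? k) (listsUpTo-unique k (2 ℕ.* k))
    2sum≡2k : ∀ {z} → Is01Partition k z → sum z + sum z ≡ 2 ℕ.* k
    2sum≡2k {z} (refl , _) = cong (_+_ (sum z)) (sym (ℕₚ.+-identityʳ (sum z)))
    to : ∀ {z} → z ∈ enum≤ k L k → z ∈ filter (is01Partition? k) space
    to {z} z∈ with enum≤-sound k L k z z∈
    ... | p@(sum≡k , jag-z) , _ = ∈-filter⁺ (is01Partition? k) (∈-listsUpTo⁺ k (2 ℕ.* k) z length≤ entries≤) p
      where
      length≤ : length z ≤ 2 ℕ.* k
      length≤ = ℕₚ.≤-trans (length≤2sum z jag-z) (ℕₚ.≤-reflexive (2sum≡2k p))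
      entries≤ : All (_≤ k) z
      entries≤ = subst (λ s → All (_≤ s) z) sum≡k (All≤sum z)
    from : ∀ {z} → z ∈ filter (is01Partition? k) space → z ∈ enum≤ k L k
    from {z} z∈ with ∈-filter⁻ (is01Partition? k) {xs = space} z∈
    ... | _ , p@(sum≡k , _) = enum≤-complete k L k z p lead≤ ℕₚ.≤-refl
      where
      lead≤ : leadingBlock z ≤ L
      lead≤ = ℕₚ.≤-trans (leadingBlock≤2sum z) (subst (λ s → s + s ≤ L) (sym sum≡k) 2k≤L)
    same-members : enum≤ k L k ∼[ set ] filter (is01Partition? k) space
    same-members = mk⇔ to from


open PowerSeries
open SymmetricSums using (symSum)
open GaussIdentity
open JaggedPartitions using (J; J-even; J-counts)
open import Data.Nat as ℕ using (zero; suc; _≤_; _≤?_; _∸_)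
import Data.Nat.Properties as ℕₚ
open import Data.Integer as ℤ using (ℤ; 0ℤ)
import Data.Integer.Properties as ℤₚ
import Data.Integer.Tactic.RingSolver as ℤ-Solver
open import Data.Empty using (⊥-elim)
open import Relation.Binary.PropositionalEquality hiding (J)
open import Relation.Nullary using (yes; no)

Θ⊛J≈[]𝟙 : ∀ N → Θ (suc N) ⊛ J (N ℕ.+ N) ≈[ N ] 𝟙
Θ⊛J≈[]𝟙 N = ⊛-cancelˡ[] N (∏geom-constant _ N) (begin
  Q N ⊛ (Θ (suc N) ⊛ J (N ℕ.+ N))  ≈⟨ ≗⇒≈[] N (⊛.x∙yz≈y∙zx (Q N) (Θ (suc N)) _) ⟩
  Θ (suc N) ⊛ (J (N ℕ.+ N) ⊛ Q N)  ≈⟨ ≗⇒≈[] N (⊛-cong (≗-refl {Θ (suc N)}) J⊛Q) ⟩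
  Θ (suc N) ⊛ (P N ⊛ P (N ℕ.+ N))  ≈⟨ ⊛-cong[] ≈[]-refl (⊛-cong[] ≈[]-refl P[2N]≈P[N]) ⟩
  Θ (suc N) ⊛ (P N ⊛ P N)          ≈⟨ Θ⊛P⊛P≈[]Q N ⟩
  Q N                              ≈⟨ ≗⇒≈[] N (≗-sym (⊛-identityʳ (Q N))) ⟩
  Q N ⊛ 𝟙                          ∎)
  where
  open ≈[]-Reasoning N
  P[2N]≈P[N] : P (N ℕ.+ N) ≈[ N ] P N
  P[2N]≈P[N] = P-stable (N ℕ.+ N) (ℕₚ.m≤m+n N N)
  J⊛Q : J (N ℕ.+ N) ⊛ Q N ≗ P N ⊛ P (N ℕ.+ N)
  J⊛Q = ≗-trans (⊛-cong (J-even N) (≗-refl {Q N}))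
        (≗-trans (⊛.xy∙z≈y∙xz _ (P N) (Q N)) (⊛-cong (≗-refl {P N}) (≗-sym (∏geom-split (λ k → k) N))))

module _ (N : ℕ) (F : Series) (F≡j : ∀ k → k ≤ N → F k ≡ + j k) where

  shift-sq≡jShift : ∀ m → shift (m ℕ.* m) F N ≡ + jShift N m
  shift-sq≡jShift m with m ℕ.* m ≤? N
  ... | yes m²≤N = trans (shift-at (m ℕ.* m) F m²≤N) (F≡j (N ∸ m ℕ.* m) (ℕₚ.m∸n≤m N (m ℕ.* m)))
  ... | no  m²≰N = shift-below (m ℕ.* m) F (ℕₚ.≰⇒> m²≰N)

  symSum-weigh-coefficient : ∀ M → symSum M (λ i → weigh i F) N ℤ.+ + 2 * altSum N M ≡ F N
  symSum-weigh-coefficient zero    = trans (ℤₚ.+-identityʳ _) (ℤₚ.*-identityˡ (F N))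
  symSum-weigh-coefficient (suc M) = begin
    (S ℤ.+ (sgn (suc (suc M)) * shift m² F N ℤ.+ sgn (suc (suc M)) * shift m² F N)) ℤ.+ + 2 * (A ℤ.+ s * x)
      ≡⟨ cong (λ t → (S ℤ.+ (t ℤ.+ t)) ℤ.+ + 2 * (A ℤ.+ s * x))
              (cong₂ _*_ (sgn-suc (suc M)) (shift-sq≡jShift (suc M))) ⟩
    (S ℤ.+ (ℤ.- s * x ℤ.+ ℤ.- s * x)) ℤ.+ + 2 * (A ℤ.+ s * x)
      ≡⟨ pairs-cancel S A s x ⟩
    S ℤ.+ + 2 * A
      ≡⟨ symSum-weigh-coefficient M ⟩
    F N ∎
    where
    open ≡-Reasoning
    S A s x : ℤ
    S = symSum M (λ i → weigh i F) N
    A = altSum N M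
    s = sgn (suc M)
    x = + jShift N (suc M)
    m² : ℕ
    m² = suc M ℕ.* suc M
    pairs-cancel : ∀ S A s x → (S ℤ.+ (ℤ.- s * x ℤ.+ ℤ.- s * x)) ℤ.+ + 2 * (A ℤ.+ s * x) ≡ S ℤ.+ + 2 * A
    pairs-cancel = ℤ-Solver.solve-∀

altSum-beyond : ∀ N → altSum N (suc N) ≡ altSum N N
altSum-beyond N = trans (cong (λ t → altSum N N ℤ.+ sgn (suc N) * + t) jShift-beyond)
                        (trans (cong (ℤ._+_ (altSum N N)) (ℤₚ.*-zeroʳ (sgn (suc N)))) (ℤₚ.+-identityʳ _))
  where
  jShift-beyond : jShift N (suc N) ≡ 0
  jShift-beyond with suc N ℕ.* suc N ≤? N
  ... | yes sq≤N = ⊥-elim (ℕₚ.<⇒≱ (ℕₚ.<-≤-trans (ℕₚ.n<1+n N) (ℕₚ.m≤m*n (suc N) (suc N))) sq≤N)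
  ... | no  _    = refl

corollary4 : (n : ℕ) → n ≥ 1 → + j n ≡ + 2 * altSum n n
corollary4 zero ()
corollary4 n@(suc _) _ = begin
  + j n
    ≡⟨ J-counts (n ℕ.+ n) n ℕₚ.≤-refl ⟨
  J (n ℕ.+ n) n
    ≡⟨ symSum-weigh-coefficient n F F≡j (suc n) ⟨
  symSum (suc n) (λ i → weigh i F) n ℤ.+ + 2 * altSum n (suc n)
    ≡⟨ cong₂ ℤ._+_ Θ⊛J[n]≡0 (cong (+ 2 *_) (altSum-beyond n)) ⟩
  0ℤ ℤ.+ + 2 * altSum n n
    ≡⟨ ℤₚ.+-identityˡ _ ⟩
  + 2 * altSum n n ∎
  where
  open ≡-Reasoning
  F : Series
  F = J (n ℕ.+ n)
  F≡j : ∀ k → k ≤ n → F k ≡ + j k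
  F≡j k k≤n = J-counts (n ℕ.+ n) k (ℕₚ.+-mono-≤ k≤n k≤n)
  Θ⊛J[n]≡0 : symSum (suc n) (λ i → weigh i F) n ≡ 0ℤ
  Θ⊛J[n]≡0 = trans (sym (Θ-⊛ (suc n) F n)) (Θ⊛J≈[]𝟙 n n ℕₚ.≤-refl)
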